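{- (i) For $n\ge1$, $nK_2$ is $1$-super graceful if and only if $n\equiv 0,1\pmod 4$; in that case it admits a $1$-super graceful labeling whose edge-label set is $[1,n]$. (ii) For $n\ge 2$, $nK_2$ is not $k$-super graceful for any odd $k\ge1$ if $n\equiv 2$ or $3\pmod 4$, and is not $k$-super graceful for any even $k\ge 2$ if $n\equiv 2\pmod 4$; consequently, if $n\equiv 2\pmod 4$ then $nK_2$ is not $k$-super graceful for any $k\ge1$. (iii) For all $n\ge 2$, $nK_2$ is not $n$-super graceful.
   Context: $nK_2$ denotes the disjoint union of $n$ copies of $K_2$. For integers $a\le b$, $[a,b]$ is the set of integers between $a$ and $b$ inclusive. For $k\ge 1$, a $k$-super graceful labeling of a graph $G=(V,E)$ with $p$ vertices and $q$ edges is a bijection $f:V\cup E\to[k,k+p+q-1]$ with $f(uv)=|f(u)-f(v)|$ for every edge $uv$; $G$ is $k$-super graceful if it admits one. -}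

module Defs where

open import Data.Nat using (ℕ; _+_; _∸_; _≤_; ∣_-_∣)
open import Data.Fin using (Fin; _↑ˡ_; _↑ʳ_)
open import Data.Sum using (_⊎_; inj₁; inj₂)
open import Data.Product using (_×_; _,_; Σ; ∃)
open import Relation.Binary.PropositionalEquality using (_≡_)
open import Function.Definitions using (Injective)

record Graph : Set where
  field
    p    : ℕ
    q    : ℕ
    ends : Fin q → Fin p × Fin p
open Graph public

Elem : Graph → Set
Elem G = Fin (p G) ⊎ Fin (q G)

record IsSuperGraceful (k : ℕ) (G : Graph) (f : Elem G → ℕ) : Set where
  field
    inRange  : ∀ x → k ≤ f x × f x ≤ k + p G + q G ∸ 1
    injective : Injective _≡_ _≡_ f
    surjective : ∀ m → k ≤ m → m ≤ k + p G + q G ∸ 1 → ∃ λ x → f x ≡ m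
    edgeLabel : ∀ e → let (u , v) = ends G e in
                f (inj₂ e) ≡ ∣ f (inj₁ u) - f (inj₁ v) ∣

SuperGraceful : ℕ → Graph → Set
SuperGraceful k G = Σ (Elem G → ℕ) (IsSuperGraceful k G)

nK₂ : ℕ → Graph
nK₂ n = record { p = n + n ; q = n ; ends = λ i → (i ↑ˡ n , n ↑ʳ i) }

EdgeLabelSet : (G : Graph) → (Elem G → ℕ) → ℕ → ℕ → Set
EdgeLabelSet G f a b =
  (∀ e → a ≤ f (inj₂ e) × f (inj₂ e) ≤ b) ×
  (∀ m → a ≤ m → m ≤ b → ∃ λ e → f (inj₂ e) ≡ m)

module Submission where

-- Every edge of n K₂ is a separate component uv, and the three
-- labels u, v, |u − v| of a component add up to 2·max(u, v).  Hence the sum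
-- of all 3n labels, which for a k-super graceful labeling is the sum of the
-- interval [k, k+3n−1], namely 3n·k + tri(3n) with tri m = 0 + ⋯ + (m − 1),
-- is even.  Writing
-- n = 4q + r, this parity fails for r = 2 (every k) and for r = 3 (odd k),
-- which gives part (ii) and the "only if" of (i).  For k = n the maxima are
-- n distinct labels below 4n, so their sum falls short of the required
-- (3n·n + tri(3n))/2 once n ≥ 2 (part (iii)).
--
-- A Skolem system of order N (a partition of [1, 2N] into pairs
-- with differences 1, …, N) yields a 1-super graceful labeling of N K₂ with
-- edge labels [1, N]: shift every pair by N and label each edge by its
-- difference.  Skolem systems are assembled from blocks of nested pairs;
-- explicit block families handle N ≡ 0, 1 (mod 4) for N ≥ 8, and the orders
-- 1, 4, 5 are given as tables checked by computation.

open import Defs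
open import Data.Nat using (ℕ; _≤_; _%_)
open import Data.Sum using (_⊎_)
open import Data.Product using (_×_; Σ)
open import Relation.Binary.PropositionalEquality using (_≡_)
open import Relation.Nullary using (¬_)
open import Function.Bundles using (_⇔_; mk⇔)

open import Data.Nat
open import Data.Nat.Properties
open import Data.Nat.DivMod using (_/_; m≡m%n+[m/n]*n; m%n<n)
open import Data.Nat.Tactic.RingSolver using (solve-∀; solve)
open import Data.Fin as Fin using (Fin; toℕ; fromℕ<; punchIn; punchOut; opposite; _↑ˡ_; _↑ʳ_; splitAt; join)
open import Data.Fin.Properties
  using (toℕ-fromℕ<; toℕ-injective; toℕ<n; punchIn-injective; punchOut-injective;
         injective⇒≤; any?; all?; splitAt-↑ˡ; splitAt-↑ʳ; splitAt-join; join-splitAt;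
         opposite-prop; opposite-involutive)
  renaming (_≟_ to _≟ᶠ_)
open import Data.Sum using (inj₁; inj₂; [_,_]′)
open import Data.Sum.Properties using (inj₁-injective)
open import Data.Product using (_,_; ∃; proj₁; proj₂)
open import Data.List using (List; []; _∷_; length; lookup)
open import Data.List.Membership.Propositional using (_∈_)
open import Data.List.Relation.Unary.Any using (here; there)
open import Data.Vec.Functional using (_++_)
open import Relation.Binary.PropositionalEquality using (_≢_; refl; sym; trans; cong; cong₂; subst; module ≡-Reasoning)
open import Relation.Nullary using (Dec; yes; no; contradiction)
open import Relation.Nullary.Decidable using (True; toWitness; _⊎-dec_)
open import Function using (_∘_; id)
open import Function.Definitions using (Injective)
open import Algebra.Properties.CommutativeMonoid.Sum +-0-commutativeMonoid
  using (sum; sum-cong-≗; sum-remove; ∑-distrib-+)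
open import Algebra.Properties.Semiring.Sum +-*-semiring using (*-distribˡ-sum)

sum-const : ∀ m c → sum {m} (λ _ → c) ≡ m * c
sum-const zero    c = refl
sum-const (suc m) c = cong (c +_) (sum-const m c)

sum-↑ : ∀ m {n} (g : Fin (m + n) → ℕ) →
        sum g ≡ sum (λ i → g (i ↑ˡ n)) + sum (λ j → g (m ↑ʳ j))
sum-↑ zero    g = refl
sum-↑ (suc m) g = trans (cong (g Fin.zero +_) (sum-↑ m (g ∘ Fin.suc))) (sym (+-assoc (g Fin.zero) _ _))

-- tri m = 0 + 1 + ⋯ + (m − 1), the least sum of m distinct naturals.
tri : ℕ → ℕ
tri zero    = 0
tri (suc m) = tri m + m

tri-double : ∀ m → 2 * tri m + m ≡ m * m
tri-double zero    = refl
tri-double (suc m) = begin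
  2 * (tri m + m) + suc m       ≡⟨ regroup (tri m) m ⟩
  (2 * tri m + m) + (2 * m + 1) ≡⟨ cong (_+ (2 * m + 1)) (tri-double m) ⟩
  m * m + (2 * m + 1)           ≡⟨ square m ⟩
  suc m * suc m                 ∎
  where
  open ≡-Reasoning
  regroup : ∀ t m → 2 * (t + m) + suc m ≡ (2 * t + m) + (2 * m + 1)
  regroup = solve-∀
  square : ∀ m → m * m + (2 * m + 1) ≡ suc m * suc m
  square = solve-∀

tri-unique : ∀ m c → 2 * c + m ≡ m * m → tri m ≡ c
tri-unique m c eq = *-cancelˡ-≡ (tri m) c 2 (+-cancelʳ-≡ m _ _ (trans (tri-double m) (sym eq)))

large-value : ∀ m (h : Fin (suc m) → ℕ) → Injective _≡_ _≡_ h → ∃ λ i → m ≤ h i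
large-value m h inj with any? (λ i → m ≤? h i)
... | yes found = found
... | no none   = contradiction (injective⇒≤ squeeze-injective) 1+n≰n
  where
  below : ∀ i → h i < m
  below i = ≰⇒> (λ m≤hi → none (i , m≤hi))
  squeeze : Fin (suc m) → Fin m
  squeeze i = fromℕ< (below i)
  squeeze-injective : Injective _≡_ _≡_ squeeze
  squeeze-injective {i} {j} eq = inj (begin
    h i             ≡⟨ toℕ-fromℕ< (below i) ⟨
    toℕ (squeeze i) ≡⟨ cong toℕ eq ⟩
    toℕ (squeeze j) ≡⟨ toℕ-fromℕ< (below j) ⟩
    h j             ∎)
    where open ≡-Reasoning

tri≤sum : ∀ m (h : Fin m → ℕ) → Injective _≡_ _≡_ h → tri m ≤ sum h
tri≤sum zero    h inj = z≤n
tri≤sum (suc m) h inj with large-value m h inj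
... | i , m≤hi = begin
  tri m + m                 ≡⟨ +-comm (tri m) m ⟩
  m + tri m                 ≤⟨ +-mono-≤ m≤hi (tri≤sum m (h ∘ punchIn i) rest-injective) ⟩
  h i + sum (h ∘ punchIn i) ≡⟨ sum-remove h ⟨
  sum h                     ∎
  where
  open ≤-Reasoning
  rest-injective : Injective _≡_ _≡_ (h ∘ punchIn i)
  rest-injective eq = punchIn-injective i _ _ (inj eq)

injective-sum-≥ : ∀ m a (h : Fin m → ℕ) → (∀ i → a ≤ h i) → Injective _≡_ _≡_ h →
                  m * a + tri m ≤ sum h
injective-sum-≥ m a h a≤h inj = begin
  m * a + tri m                   ≤⟨ +-monoʳ-≤ (m * a) (tri≤sum m lowered lowered-injective) ⟩
  m * a + sum lowered             ≡⟨ +-comm (m * a) (sum lowered) ⟩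
  sum lowered + m * a             ≡⟨ cong (sum lowered +_) (sum-const m a) ⟨
  sum lowered + sum {m} (λ _ → a) ≡⟨ ∑-distrib-+ lowered (λ _ → a) ⟨
  sum (λ i → lowered i + a)       ≡⟨ sum-cong-≗ (λ i → m∸n+n≡m (a≤h i)) ⟩
  sum h                           ∎
  where
  open ≤-Reasoning
  lowered : Fin m → ℕ
  lowered i = h i ∸ a
  lowered-injective : Injective _≡_ _≡_ lowered
  lowered-injective {i} {j} eq = inj (∸-cancelʳ-≡ (a≤h i) (a≤h j) eq)

-- m distinct naturals that are all < B sum to at most m·B − tri m − m
-- (reflect i ↦ B − 1 − h i and apply tri≤sum).
injective-sum-< : ∀ m B (h : Fin m → ℕ) → (∀ i → h i < B) → Injective _≡_ _≡_ h →
                  sum h + (tri m + m) ≤ m * B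
injective-sum-< m B h h<B inj = begin
  sum h + (tri m + m)                 ≡⟨ regroup (sum h) (tri m) m ⟩
  tri m + (m + sum h)                 ≤⟨ +-monoˡ-≤ (m + sum h) (tri≤sum m reflected reflected-injective) ⟩
  sum reflected + (m + sum h)         ≡⟨ cong (sum reflected +_) count-successors ⟨
  sum reflected + sum (suc ∘ h)       ≡⟨ ∑-distrib-+ reflected (suc ∘ h) ⟨
  sum (λ i → reflected i + suc (h i)) ≡⟨ sum-cong-≗ (λ i → m∸n+n≡m (h<B i)) ⟩
  sum {m} (λ _ → B)                   ≡⟨ sum-const m B ⟩
  m * B                               ∎
  where
  open ≤-Reasoning
  reflected : Fin m → ℕ
  reflected i = B ∸ suc (h i)
  reflected-injective : Injective _≡_ _≡_ reflected
  reflected-injective eq = inj (suc-injective (∸-cancelˡ-≡ (h<B _) (h<B _) eq))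
  regroup : ∀ s t m → s + (t + m) ≡ t + (m + s)
  regroup = solve-∀
  count-successors : sum (suc ∘ h) ≡ m + sum h
  count-successors = trans (∑-distrib-+ {m} (λ _ → 1) h) (cong (_+ sum h) (trans (sum-const m 1) (*-identityʳ m)))

interval-sum : ∀ m a (h : Fin m → ℕ) → Injective _≡_ _≡_ h → (∀ i → a ≤ h i × h i < a + m) →
               sum h ≡ m * a + tri m
interval-sum m a h inj bounds = ≤-antisym upper (injective-sum-≥ m a h (proj₁ ∘ bounds) inj)
  where
  square-split : m * (a + m) ≡ (m * a + tri m) + (tri m + m)
  square-split = begin
    m * (a + m)                   ≡⟨ *-distribˡ-+ m a m ⟩
    m * a + m * m                 ≡⟨ cong (m * a +_) (tri-double m) ⟨
    m * a + (2 * tri m + m)       ≡⟨ regroup (m * a) (tri m) m ⟩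
    (m * a + tri m) + (tri m + m) ∎
    where
    open ≡-Reasoning
    regroup : ∀ x t m → x + (2 * t + m) ≡ (x + t) + (t + m)
    regroup = solve-∀
  upper : sum h ≤ m * a + tri m
  upper = +-cancelʳ-≤ (tri m + m) (sum h) (m * a + tri m)
    (subst (sum h + (tri m + m) ≤_) square-split (injective-sum-< m (a + m) h (proj₂ ∘ bounds) inj))

-- x + y + |x − y| = 2·max(x, y): the three labels of one K₂ component.
component-sum-≤ : ∀ {x y} → x ≤ y → x + y + ∣ x - y ∣ ≡ 2 * (x ⊔ y)
component-sum-≤ {x} {y} x≤y = begin
  x + y + ∣ x - y ∣  ≡⟨ cong (x + y +_) (m≤n⇒∣m-n∣≡n∸m x≤y) ⟩
  x + y + (y ∸ x)    ≡⟨ cong (_+ (y ∸ x)) (+-comm x y) ⟩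
  y + x + (y ∸ x)    ≡⟨ +-assoc y x (y ∸ x) ⟩
  y + (x + (y ∸ x))  ≡⟨ cong (y +_) (m+[n∸m]≡n x≤y) ⟩
  y + y              ≡⟨ cong (y +_) (+-identityʳ y) ⟨
  2 * y              ≡⟨ cong (2 *_) (m≤n⇒m⊔n≡n x≤y) ⟨
  2 * (x ⊔ y)        ∎
  where open ≡-Reasoning

component-sum : ∀ x y → x + y + ∣ x - y ∣ ≡ 2 * (x ⊔ y)
component-sum x y with ≤-total x y
... | inj₁ x≤y = component-sum-≤ x≤y
... | inj₂ y≤x = begin
  x + y + ∣ x - y ∣  ≡⟨ cong₂ _+_ (+-comm x y) (∣-∣-comm x y) ⟩
  y + x + ∣ y - x ∣  ≡⟨ component-sum-≤ y≤x ⟩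
  2 * (y ⊔ x)        ≡⟨ cong (2 *_) (⊔-comm y x) ⟩
  2 * (x ⊔ y)        ∎
  where open ≡-Reasoning

-- For y ≥ 1, x ≤ y − 1 means x < y; turns the upper end k + p + q − 1 of the
-- label interval into a strict bound.
≤∸1⇒< : ∀ {x y} → 1 ≤ y → x ≤ y ∸ 1 → x < y
≤∸1⇒< {y = suc y} _ x≤y = s≤s x≤y

module GracefulLabelSums {n k : ℕ} (k≥1 : 1 ≤ k) (f : Elem (nK₂ n) → ℕ)
                         (graceful : IsSuperGraceful k (nK₂ n) f) where
  open IsSuperGraceful graceful

  label< : ∀ x → f x < k + (n + n + n)
  label< x = subst (f x <_) (+-assoc k (n + n) n)
    (≤∸1⇒< (≤-trans k≥1 (≤-trans (m≤m+n k (n + n)) (m≤m+n _ n))) (proj₂ (inRange x)))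

  allLabels : Fin (n + n + n) → ℕ
  allLabels = f ∘ splitAt (n + n)

  allLabels-injective : Injective _≡_ _≡_ allLabels
  allLabels-injective {i} {j} eq = begin
    i                                  ≡⟨ join-splitAt (n + n) n i ⟨
    join (n + n) n (splitAt (n + n) i) ≡⟨ cong (join (n + n) n) (injective eq) ⟩
    join (n + n) n (splitAt (n + n) j) ≡⟨ join-splitAt (n + n) n j ⟩
    j                                  ∎
    where open ≡-Reasoning

  allLabels-sum : sum allLabels ≡ (n + n + n) * k + tri (n + n + n)
  allLabels-sum = interval-sum (n + n + n) k allLabels allLabels-injective
    (λ i → proj₁ (inRange _) , label< _)

  left right edgeMax : Fin n → ℕ
  left e    = f (inj₁ (e ↑ˡ n))
  right e   = f (inj₁ (n ↑ʳ e))
  edgeMax e = left e ⊔ right e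

  vertex-sum : sum (f ∘ inj₁) ≡ sum left + sum right
  vertex-sum = sum-↑ n (f ∘ inj₁)

  allLabels-split : sum allLabels ≡ sum (f ∘ inj₁) + sum (f ∘ inj₂)
  allLabels-split = trans (sum-↑ (n + n) allLabels)
    (cong₂ _+_ (sum-cong-≗ (λ w → cong f (splitAt-↑ˡ (n + n) w n)))
               (sum-cong-≗ (λ e → cong f (splitAt-↑ʳ (n + n) n e))))

  edgeMax-sum : 2 * sum edgeMax ≡ (n + n + n) * k + tri (n + n + n)
  edgeMax-sum = begin
    2 * sum edgeMax                                     ≡⟨ *-distribˡ-sum 2 edgeMax ⟩
    sum (λ e → 2 * edgeMax e)                           ≡⟨ sum-cong-≗ (λ e → component-sum (left e) (right e)) ⟨
    sum (λ e → left e + right e + ∣ left e - right e ∣) ≡⟨ ∑-distrib-+ (λ e → left e + right e) _ ⟩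
    sum (λ e → left e + right e) + sum (λ e → ∣ left e - right e ∣)
      ≡⟨ cong₂ _+_ (trans (∑-distrib-+ left right) (sym vertex-sum)) (sum-cong-≗ (sym ∘ edgeLabel)) ⟩
    sum (f ∘ inj₁) + sum (f ∘ inj₂)                     ≡⟨ allLabels-split ⟨
    sum allLabels                                       ≡⟨ allLabels-sum ⟩
    (n + n + n) * k + tri (n + n + n)                   ∎
    where open ≡-Reasoning

  component : Fin (n + n) → Fin n
  component w = [ id , id ]′ (splitAt n w)

  max-attained : ∀ e → ∃ λ w → component w ≡ e × f (inj₁ w) ≡ edgeMax e
  max-attained e with ⊔-sel (left e) (right e)
  ... | inj₁ eq = e ↑ˡ n , cong [ id , id ]′ (splitAt-↑ˡ n e n) , sym eq
  ... | inj₂ eq = n ↑ʳ e , cong [ id , id ]′ (splitAt-↑ʳ n n e) , sym eq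

  edgeMax-injective : Injective _≡_ _≡_ edgeMax
  edgeMax-injective {e} {e′} eq with max-attained e | max-attained e′
  ... | w , refl , fw | w′ , refl , fw′ =
    cong component (inj₁-injective (injective (trans fw (trans eq (sym fw′)))))

  edgeMax< : ∀ e → edgeMax e < k + (n + n + n)
  edgeMax< e with max-attained e
  ... | w , _ , fw = subst (_< k + (n + n + n)) fw (label< (inj₁ w))

label-sum-even : ∀ n k → 1 ≤ k → SuperGraceful k (nK₂ n) →
                 ∃ λ X → (n + n + n) * k + tri (n + n + n) ≡ 2 * X
label-sum-even n k k≥1 (f , graceful) = sum edgeMax , sym edgeMax-sum
  where open GracefulLabelSums k≥1 f graceful

residue : ∀ n d .{{_ : NonZero d}} {r} → n % d ≡ r → n ≡ r + (n / d) * d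
residue n d eq = trans (m≡m%n+[m/n]*n n d) (cong (_+ (n / d) * d) eq)

label-sum-odd-2 : ∀ n q k → n ≡ 2 + q * 4 →
                  ∃ λ Y → (n + n + n) * k + tri (n + n + n) ≡ suc (2 * Y)
label-sum-odd-2 n q k refl = (3 + 6 * q) * k + 7 + 33 * q + 36 * (q * q) ,
  trans (cong ((n + n + n) * k +_) (tri-unique (n + n + n) _ (gauss q))) (odd-form q k)
  where
  gauss : ∀ q → let n = 2 + q * 4 in
          2 * (15 + 66 * q + 72 * (q * q)) + (n + n + n) ≡ (n + n + n) * (n + n + n)
  gauss = solve-∀
  odd-form : ∀ q k → let n = 2 + q * 4 in
           (n + n + n) * k + (15 + 66 * q + 72 * (q * q)) ≡
           suc (2 * ((3 + 6 * q) * k + 7 + 33 * q + 36 * (q * q)))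
  odd-form = solve-∀

label-sum-odd-3 : ∀ n q k j → n ≡ 3 + q * 4 → k ≡ 1 + j * 2 →
                  ∃ λ Y → (n + n + n) * k + tri (n + n + n) ≡ suc (2 * Y)
label-sum-odd-3 n q k j refl refl = (9 + 12 * q) * j + 22 + 57 * q + 36 * (q * q) ,
  trans (cong ((n + n + n) * k +_) (tri-unique (n + n + n) _ (gauss q))) (odd-form q j)
  where
  gauss : ∀ q → let n = 3 + q * 4 in
          2 * (36 + 102 * q + 72 * (q * q)) + (n + n + n) ≡ (n + n + n) * (n + n + n)
  gauss = solve-∀
  odd-form : ∀ q j → let n = 3 + q * 4 in
             (n + n + n) * (1 + j * 2) + (36 + 102 * q + 72 * (q * q)) ≡
             suc (2 * ((9 + 12 * q) * j + 22 + 57 * q + 36 * (q * q)))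
  odd-form = solve-∀

not-graceful-2 : ∀ n k → n % 4 ≡ 2 → 1 ≤ k → ¬ SuperGraceful k (nK₂ n)
not-graceful-2 n k n≡2 k≥1 graceful
  with label-sum-even n k k≥1 graceful | label-sum-odd-2 n (n / 4) k (residue n 4 n≡2)
... | X , even | Y , odd = even≢odd X Y (trans (sym even) odd)

not-graceful-3 : ∀ n k → n % 4 ≡ 3 → 1 ≤ k → k % 2 ≡ 1 → ¬ SuperGraceful k (nK₂ n)
not-graceful-3 n k n≡3 k≥1 k-odd graceful
  with label-sum-even n k k≥1 graceful
     | label-sum-odd-3 n (n / 4) k (k / 2) (residue n 4 n≡3) (residue k 2 k-odd)
... | X , even | Y , odd = even≢odd X Y (trans (sym even) odd)

-- With S the sum of the n edge maxima of an
-- n-super graceful labeling: 2S = 3n·n + tri 3n, while S + tri n + n ≤ n·4n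
-- because the maxima are n distinct labels below 4n.  Together: n² ≤ n.
n-graceful-arith : ∀ n S t₃ₙ tₙ →
  2 * S ≡ (n + n + n) * n + t₃ₙ → 2 * t₃ₙ + (n + n + n) ≡ (n + n + n) * (n + n + n) →
  2 * tₙ + n ≡ n * n → S + (tₙ + n) ≤ n * (n + (n + n + n)) → n * n ≤ n
n-graceful-arith n S t₃ₙ tₙ maxima gauss₃ₙ gaussₙ upper =
  +-cancelˡ-≤ (16 * (n * n) + 2 * n) (n * n) n (begin
    16 * (n * n) + 2 * n + n * n                ≡⟨ e₁ n ⟨
    (n + n + n) * (n + n + n) + 8 * (n * n) + 2 * n
                                                ≡⟨ cong (λ a → a + 8 * (n * n) + 2 * n) gauss₃ₙ ⟨
    2 * t₃ₙ + (n + n + n) + 8 * (n * n) + 2 * n ≡⟨ e₂ n t₃ₙ ⟨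
    2 * ((n + n + n) * n + t₃ₙ) + 2 * (n * n) + 5 * n
                                                ≡⟨ cong₂ (λ a b → 2 * a + 2 * b + 5 * n) maxima gaussₙ ⟨
    2 * (2 * S) + 2 * (2 * tₙ + n) + 5 * n      ≡⟨ e₃ n S tₙ ⟩
    4 * (S + (tₙ + n)) + 3 * n                  ≤⟨ +-monoˡ-≤ (3 * n) (*-monoʳ-≤ 4 upper) ⟩
    4 * (n * (n + (n + n + n))) + 3 * n         ≡⟨ e₄ n ⟩
    16 * (n * n) + 2 * n + n                    ∎)
  where
  open ≤-Reasoning
  e₁ : ∀ n → (n + n + n) * (n + n + n) + 8 * (n * n) + 2 * n ≡ 16 * (n * n) + 2 * n + n * n
  e₁ = solve-∀
  e₂ : ∀ n t → 2 * ((n + n + n) * n + t) + 2 * (n * n) + 5 * n ≡ 2 * t + (n + n + n) + 8 * (n * n) + 2 * n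
  e₂ = solve-∀
  e₃ : ∀ n S t → 2 * (2 * S) + 2 * (2 * t + n) + 5 * n ≡ 4 * (S + (t + n)) + 3 * n
  e₃ = solve-∀
  e₄ : ∀ n → 4 * (n * (n + (n + n + n))) + 3 * n ≡ 16 * (n * n) + 2 * n + n
  e₄ = solve-∀

not-n-graceful : ∀ n → 2 ≤ n → ¬ SuperGraceful n (nK₂ n)
not-n-graceful n n≥2@(s≤s (s≤s _)) (f , graceful) =
  <⇒≱ (m<m*n n n n≥2)
    (n-graceful-arith n (sum edgeMax) (tri (n + n + n)) (tri n)
      (edgeMax-sum) (tri-double (n + n + n)) (tri-double n)
      (injective-sum-< n (n + (n + n + n)) edgeMax edgeMax< edgeMax-injective))
  where open GracefulLabelSums (≤-trans (s≤s z≤n) n≥2) f graceful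

Covers : (ℕ → Set) → ℕ → Set
Covers P B = ∀ m → 1 ≤ m → m ≤ B → P m

module _ {N : ℕ} (start gap : Fin N → ℕ) where

  HasGap : ℕ → Set
  HasGap m = ∃ λ e → gap e ≡ m

  HasPoint : ℕ → Set
  HasPoint p = ∃ λ e → start e ≡ p ⊎ start e + gap e ≡ p

-- Counting then forces the
-- pairs to partition [1, 2N] with gaps exactly 1, …, N.
record SkolemSystem (N : ℕ) : Set where
  field
    start gap    : Fin N → ℕ
    gaps-cover   : Covers (HasGap start gap) N
    points-cover : Covers (HasPoint start gap) (N + N)

-- An injective map Fin M → Fin M is onto: a missed value would give an
-- injection Fin M → Fin (M − 1).
injective⇒onto : ∀ {M} (g : Fin M → Fin M) → Injective _≡_ _≡_ g → ∀ i → ∃ λ j → g j ≡ i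
injective⇒onto {suc M} g inj i with any? (λ j → g j ≟ᶠ i)
... | yes found = found
... | no missed = contradiction (injective⇒≤ avoid-injective) 1+n≰n
  where
  misses : ∀ j → i ≢ g j
  misses j i≡gj = missed (j , sym i≡gj)
  avoid : Fin (suc M) → Fin M
  avoid j = punchOut (misses j)
  avoid-injective : Injective _≡_ _≡_ avoid
  avoid-injective {j} {j′} eq = inj (punchOut-injective (misses j) (misses j′) eq)

onto-interval : ∀ {M} (F : Fin M → ℕ) → Covers (λ m → ∃ λ i → F i ≡ m) M →
                (∀ i → 1 ≤ F i × F i ≤ M) × Injective _≡_ _≡_ F
onto-interval {M} F onto = range , F-injective
  where
  section : Fin M → Fin M
  section j = proj₁ (onto (suc (toℕ j)) (s≤s z≤n) (toℕ<n j))
  F-section : ∀ j → F (section j) ≡ suc (toℕ j)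
  F-section j = proj₂ (onto (suc (toℕ j)) (s≤s z≤n) (toℕ<n j))
  section-injective : Injective _≡_ _≡_ section
  section-injective {j} {j′} eq =
    toℕ-injective (suc-injective (trans (sym (F-section j)) (trans (cong F eq) (F-section j′))))
  range : ∀ i → 1 ≤ F i × F i ≤ M
  range i with injective⇒onto section section-injective i
  ... | j , refl = subst (λ m → 1 ≤ m × m ≤ M) (sym (F-section j)) (s≤s z≤n , toℕ<n j)
  F-injective : Injective _≡_ _≡_ F
  F-injective {i} {i′} eq
    with injective⇒onto section section-injective i | injective⇒onto section section-injective i′
  ... | j , refl | j′ , refl =
    cong section (toℕ-injective (suc-injective (trans (sym (F-section j)) (trans eq (F-section j′)))))

GoodLabeling : ℕ → Set
GoodLabeling N = Σ (Elem (nK₂ N) → ℕ) λ f → IsSuperGraceful 1 (nK₂ N) f × EdgeLabelSet (nK₂ N) f 1 N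

skolem⇒labeling : ∀ {N} → SkolemSystem N → GoodLabeling N
skolem⇒labeling {N} S = f , graceful , (proj₁ gaps-bijective , gaps-cover)
  where
  open SkolemSystem S
  f : Elem (nK₂ N) → ℕ
  f (inj₁ v) = [ (λ e → N + start e) , (λ e → N + start e + gap e) ]′ (splitAt N v)
  f (inj₂ e) = gap e

  f-left : ∀ e → f (inj₁ (e ↑ˡ N)) ≡ N + start e
  f-left e = cong [ (λ e → N + start e) , (λ e → N + start e + gap e) ]′ (splitAt-↑ˡ N e N)
  f-right : ∀ e → f (inj₁ (N ↑ʳ e)) ≡ N + start e + gap e
  f-right e = cong [ (λ e → N + start e) , (λ e → N + start e + gap e) ]′ (splitAt-↑ʳ N N e)

  onto : Covers (λ m → ∃ λ x → f x ≡ m) (N + N + N)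
  onto m 1≤m m≤3N with m ≤? N
  ... | yes m≤N = let e , gap≡m = gaps-cover m 1≤m m≤N in inj₂ e , gap≡m
  ... | no m≰N with points-cover (m ∸ N) (m<n⇒0<n∸m (≰⇒> m≰N))
                      (subst (m ∸ N ≤_) (m+n∸n≡m (N + N) N) (∸-monoˡ-≤ N m≤3N))
  ...   | e , inj₁ start≡ = inj₁ (e ↑ˡ N) , (begin
    f (inj₁ (e ↑ˡ N)) ≡⟨ f-left e ⟩
    N + start e       ≡⟨ cong (N +_) start≡ ⟩
    N + (m ∸ N)       ≡⟨ m+[n∸m]≡n (<⇒≤ (≰⇒> m≰N)) ⟩
    m                 ∎)
    where open ≡-Reasoning
  ...   | e , inj₂ end≡ = inj₁ (N ↑ʳ e) , (begin
    f (inj₁ (N ↑ʳ e))   ≡⟨ f-right e ⟩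
    N + start e + gap e ≡⟨ +-assoc N (start e) (gap e) ⟩
    N + (start e + gap e) ≡⟨ cong (N +_) end≡ ⟩
    N + (m ∸ N)         ≡⟨ m+[n∸m]≡n (<⇒≤ (≰⇒> m≰N)) ⟩
    m                   ∎)
    where open ≡-Reasoning

  allLabels : Fin (N + N + N) → ℕ
  allLabels = f ∘ splitAt (N + N)
  allLabels-join : ∀ x → allLabels (join (N + N) N x) ≡ f x
  allLabels-join x = cong f (splitAt-join (N + N) N x)
  labels-bijective : (∀ i → 1 ≤ allLabels i × allLabels i ≤ N + N + N) × Injective _≡_ _≡_ allLabels
  labels-bijective = onto-interval allLabels (λ m 1≤m m≤3N →
    let x , fx≡m = onto m 1≤m m≤3N in join (N + N) N x , trans (allLabels-join x) fx≡m)
  f-injective : Injective _≡_ _≡_ f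
  f-injective {x} {y} fx≡fy = begin
    x                                  ≡⟨ splitAt-join (N + N) N x ⟨
    splitAt (N + N) (join (N + N) N x) ≡⟨ cong (splitAt (N + N)) (proj₂ labels-bijective
                                            (trans (allLabels-join x) (trans fx≡fy (sym (allLabels-join y))))) ⟩
    splitAt (N + N) (join (N + N) N y) ≡⟨ splitAt-join (N + N) N y ⟩
    y                                  ∎
    where open ≡-Reasoning

  gaps-bijective : (∀ e → 1 ≤ gap e × gap e ≤ N) × Injective _≡_ _≡_ gap
  gaps-bijective = onto-interval gap gaps-cover

  graceful : IsSuperGraceful 1 (nK₂ N) f
  graceful = record
    { inRange    = λ x → subst (λ m → 1 ≤ m × m ≤ N + N + N) (allLabels-join x)
                                (proj₁ labels-bijective (join (N + N) N x))
    ; injective  = f-injective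
    ; surjective = onto
    ; edgeLabel  = λ e → sym (trans (cong₂ ∣_-_∣ (f-left e) (f-right e)) (∣m-m+n∣≡n (N + start e) (gap e)))
    }

covers-by-check : ∀ {P : ℕ → Set} {B} → (∀ (i : Fin B) → P (suc (toℕ i))) → Covers P B
covers-by-check check zero    () _
covers-by-check {P} check (suc m) _ m<B = subst (P ∘ suc) (toℕ-fromℕ< m<B) (check (fromℕ< m<B))

covers? : ∀ {P : ℕ → Set} → (∀ m → Dec (P m)) → ∀ B → Dec (∀ (i : Fin B) → P (suc (toℕ i)))
covers? P? B = all? (λ i → P? (suc (toℕ i)))

module _ {N : ℕ} (start gap : Fin N → ℕ) where

  hasGap? : ∀ m → Dec (HasGap start gap m)
  hasGap? m = any? (λ e → gap e ≟ m)

  hasPoint? : ∀ p → Dec (HasPoint start gap p)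
  hasPoint? p = any? (λ e → (start e ≟ p) ⊎-dec (start e + gap e ≟ p))

tableStart tableGap : (table : List (ℕ × ℕ)) → Fin (length table) → ℕ
tableStart table = proj₁ ∘ lookup table
tableGap   table = proj₂ ∘ lookup table

-- A Skolem system listed as (start, gap) pairs; both coverage conditions are
-- decided by evaluation, so the implicit proofs are trivial for a valid table.
tableSystem : (table : List (ℕ × ℕ)) →
  {gaps-ok : True (covers? (hasGap? (tableStart table) (tableGap table)) (length table))} →
  {points-ok : True (covers? (hasPoint? (tableStart table) (tableGap table)) (length table + length table))} →
  SkolemSystem (length table)
tableSystem table {gaps-ok} {points-ok} = record
  { start        = tableStart table
  ; gap          = tableGap table
  ; gaps-cover   = covers-by-check (toWitness gaps-ok)
  ; points-cover = covers-by-check (toWitness points-ok)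
  }

order1 : SkolemSystem 1
order1 = tableSystem ((1 , 1) ∷ [])

order4 : SkolemSystem 4
order4 = tableSystem ((1 , 1) ∷ (4 , 2) ∷ (5 , 3) ∷ (3 , 4) ∷ [])

order5 : SkolemSystem 5
order5 = tableSystem ((8 , 1) ∷ (1 , 2) ∷ (4 , 3) ∷ (2 , 4) ∷ (5 , 5) ∷ [])

-- P holds on the interval [a, b).  (A record rather than a function type, so
-- that the endpoints of a segment are determined by its expected type.)
record Segment (P : ℕ → Set) (a b : ℕ) : Set where
  constructor mkSegment
  field holds : ∀ p → a ≤ p → p < b → P p
open Segment

segment : ∀ {P : ℕ → Set} a L → (∀ i → i < L → P (a + i)) → Segment P a (a + L)
segment {P} a L at = mkSegment λ p a≤p p<a+L → subst P (m+[n∸m]≡n a≤p)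
  (at (p ∸ a) (+-cancelˡ-< a _ _ (subst (_< a + L) (sym (m+[n∸m]≡n a≤p)) p<a+L)))

concat : ∀ {P : ℕ → Set} {a b b′ c} → Segment P a b → Segment P b′ c → b ≡ b′ → Segment P a c
concat {P} {a} {b} {_} {c} lower upper refl = mkSegment joined
  where
  joined : ∀ p → a ≤ p → p < c → P p
  joined p a≤p p<c with p <? b
  ... | yes p<b = holds lower p a≤p p<b
  ... | no  p≮b = holds upper p (≮⇒≥ p≮b) p<c

infixr 4 concat
syntax concat lower upper b≡b′ = lower ++⟨ b≡b′ ⟩ upper

fit : ∀ {P : ℕ → Set} {a b c} → Segment P a b → b ≡ c → Segment P a c
fit seg refl = seg

-- The block  block a s L  consists of the L nested pairs
--   (a + r, a + 2L − 1 + s − r),  r < L,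
-- with starts filling [a, a + L), ends filling [a + L + s, a + 2L + s) and
-- gaps s + 1, s + 3, …, s + 2L − 1.
record Block : Set where
  constructor block
  field first spread size : ℕ
open Block

blockPair : (x : Block) → Fin (size x) → ℕ × ℕ
blockPair x r = first x + toℕ r , suc (spread x) + 2 * toℕ (opposite r)

total : List Block → ℕ
total []       = 0
total (x ∷ bs) = size x + total bs

pairs : (bs : List Block) → Fin (total bs) → ℕ × ℕ
pairs []       ()
pairs (x ∷ bs) = blockPair x ++ pairs bs

starts gaps : (bs : List Block) → Fin (total bs) → ℕ
starts bs = proj₁ ∘ pairs bs
gaps   bs = proj₂ ∘ pairs bs

Point Gap : List Block → ℕ → Set
Point bs = HasPoint (starts bs) (gaps bs)
Gap   bs = HasGap (starts bs) (gaps bs)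

pair-present : ∀ bs {x} → x ∈ bs → (r : Fin (size x)) → ∃ λ e → pairs bs e ≡ blockPair x r
pair-present (x ∷ bs) (here refl) r = r ↑ˡ total bs , cong [ blockPair x , pairs bs ]′ (splitAt-↑ˡ (size x) r (total bs))
pair-present (y ∷ bs) (there x∈bs) r with pair-present bs x∈bs r
... | e , pair≡ = size y ↑ʳ e , trans (cong [ blockPair y , pairs bs ]′ (splitAt-↑ʳ (size y) (total bs) e)) pair≡

-- The pair of a block with the i-th largest gap, i.e. pair L − 1 − i.
pair-from-top : ∀ {L} {i} → i < L → Fin L
pair-from-top i<L = opposite (fromℕ< i<L)

toℕ-opposite-from-top : ∀ {L i} (i<L : i < L) → toℕ (opposite (pair-from-top i<L)) ≡ i
toℕ-opposite-from-top i<L = trans (cong toℕ (opposite-involutive (fromℕ< i<L))) (toℕ-fromℕ< i<L)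

module _ (bs : List Block) {a s L : ℕ} (x∈bs : block a s L ∈ bs) where

  block-start : ∀ i → i < L → Point bs (a + i)
  block-start i i<L with pair-present bs x∈bs (fromℕ< i<L)
  ... | e , pair≡ = e , inj₁ (trans (cong proj₁ pair≡) (cong (a +_) (toℕ-fromℕ< i<L)))

  block-end : ∀ i → i < L → Point bs (a + L + s + i)
  block-end i i<L with pair-present bs x∈bs (pair-from-top i<L)
  ... | e , pair≡ = e , inj₂ (trans (cong₂ _+_ (cong proj₁ pair≡) (cong proj₂ pair≡)) end≡)
    where
    r : Fin L
    r = pair-from-top i<L
    complement : toℕ r + suc i ≡ L
    complement = trans (cong (_+ suc i) (trans (opposite-prop (fromℕ< i<L))
                                              (cong (λ j → L ∸ suc j) (toℕ-fromℕ< i<L))))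
                       (m∸n+n≡m i<L)
    regroup : ∀ a r s i → a + r + (suc s + 2 * i) ≡ a + (r + suc i) + s + i
    regroup = solve-∀
    end≡ : a + toℕ r + (suc s + 2 * toℕ (opposite r)) ≡ a + L + s + i
    end≡ = begin
      a + toℕ r + (suc s + 2 * toℕ (opposite r)) ≡⟨ cong (λ j → a + toℕ r + (suc s + 2 * j)) (toℕ-opposite-from-top i<L) ⟩
      a + toℕ r + (suc s + 2 * i)               ≡⟨ regroup a (toℕ r) s i ⟩
      a + (toℕ r + suc i) + s + i               ≡⟨ cong (λ l → a + l + s + i) complement ⟩
      a + L + s + i                             ∎
      where open ≡-Reasoning

  block-gap : ∀ i → i < L → Gap bs (suc s + 2 * i)
  block-gap i i<L with pair-present bs x∈bs (pair-from-top i<L)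
  ... | e , pair≡ = e , trans (cong proj₂ pair≡) (cong (λ j → suc s + 2 * j) (toℕ-opposite-from-top i<L))

  starts-of : Segment (Point bs) a (a + L)
  starts-of = segment a L block-start

  ends-of : Segment (Point bs) (a + L + s) (a + L + s + L)
  ends-of = segment (a + L + s) L block-end

  odd-gaps-of : ∀ c → s ≡ 2 * c → Segment (λ u → Gap bs (1 + 2 * u)) c (c + L)
  odd-gaps-of c s≡2c = segment c L (λ i i<L → subst (Gap bs) (odd i) (block-gap i i<L))
    where
    shape : ∀ c i → suc (2 * c) + 2 * i ≡ 1 + 2 * (c + i)
    shape = solve-∀
    odd : ∀ i → suc s + 2 * i ≡ 1 + 2 * (c + i)
    odd i = trans (cong (λ s → suc s + 2 * i) s≡2c) (shape c i)

  even-gaps-of : ∀ c → s ≡ 1 + 2 * c → Segment (λ u → Gap bs (2 + 2 * u)) c (c + L)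
  even-gaps-of c s≡1+2c = segment c L (λ i i<L → subst (Gap bs) (even i) (block-gap i i<L))
    where
    shape : ∀ c i → suc (1 + 2 * c) + 2 * i ≡ 2 + 2 * (c + i)
    shape = solve-∀
    even : ∀ i → suc s + 2 * i ≡ 2 + 2 * (c + i)
    even i = trans (cong (λ s → suc s + 2 * i) s≡1+2c) (shape c i)

odd-or-even : ∀ m → 1 ≤ m → ∃ λ u → m ≡ 1 + 2 * u ⊎ m ≡ 2 + 2 * u
odd-or-even 1 _ = 0 , inj₁ refl
odd-or-even 2 _ = 0 , inj₂ refl
odd-or-even (suc (suc (suc m))) _ with odd-or-even (suc m) (s≤s z≤n)
... | u , inj₁ eq = suc u , inj₁ (trans (cong (2 +_) eq) (cong suc (sym (*-suc 2 u))))
... | u , inj₂ eq = suc u , inj₂ (trans (cong (2 +_) eq) (cong (2 +_) (sym (*-suc 2 u))))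

gaps-by-parity : ∀ bs N {H₁ H₂} →
  Segment (λ u → Gap bs (1 + 2 * u)) 0 H₁ → Segment (λ u → Gap bs (2 + 2 * u)) 0 H₂ →
  N ≤ 2 * H₁ → N ≤ 1 + 2 * H₂ → Covers (Gap bs) N
gaps-by-parity bs N odd even N≤2H₁ N≤1+2H₂ m 1≤m m≤N with odd-or-even m 1≤m
... | u , inj₁ refl = holds odd u z≤n (*-cancelˡ-< 2 u _ (≤-trans m≤N N≤2H₁))
... | u , inj₂ refl = holds even u z≤n (*-cancelˡ-< 2 u _ (s≤s⁻¹ (≤-trans m≤N N≤1+2H₂)))

blockSystem : ∀ bs {N} → total bs ≡ N → Segment (Point bs) 1 (suc (N + N)) → Covers (Gap bs) N →
              SkolemSystem N
blockSystem bs refl points gaps-cover = record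
  { start        = starts bs
  ; gap          = gaps bs
  ; gaps-cover   = gaps-cover
  ; points-cover = λ p 1≤p p≤2N → holds points p 1≤p (s≤s p≤2N)
  }

module SkolemOrder8+4t (t : ℕ) where
  A B C D E F : Block
  A = block (4 * t + 8) 1 (2 * t + 4)
  B = block 1 (2 * t + 4) (t + 1)
  C = block (t + 2) 0 1
  D = block (t + 4) 2 t
  E = block (2 * t + 4) (2 * t + 2) 1
  F = block (2 * t + 5) (4 * t + 6) 1

  blocks : List Block
  blocks = A ∷ B ∷ C ∷ D ∷ E ∷ F ∷ []

  ∈A : A ∈ blocks
  ∈A = here refl
  ∈B : B ∈ blocks
  ∈B = there (here refl)
  ∈C : C ∈ blocks
  ∈C = there (there (here refl))
  ∈D : D ∈ blocks
  ∈D = there (there (there (here refl)))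
  ∈E : E ∈ blocks
  ∈E = there (there (there (there (here refl))))
  ∈F : F ∈ blocks
  ∈F = there (there (there (there (there (here refl)))))

  blocks-total : total blocks ≡ 8 + t * 4
  blocks-total = sizes t
    where
    sizes : ∀ t → 2 * t + 4 + (t + 1 + (1 + (t + (1 + (1 + 0))))) ≡ 8 + t * 4
    sizes = solve-∀

  points : Segment (Point blocks) 1 (suc ((8 + t * 4) + (8 + t * 4)))
  points =
       starts-of blocks ∈B ++⟨ solve (t ∷ []) ⟩ starts-of blocks ∈C ++⟨ solve (t ∷ []) ⟩ ends-of blocks ∈C
    ++⟨ solve (t ∷ []) ⟩ starts-of blocks ∈D ++⟨ solve (t ∷ []) ⟩ starts-of blocks ∈E
    ++⟨ solve (t ∷ []) ⟩ starts-of blocks ∈F ++⟨ solve (t ∷ []) ⟩ ends-of blocks ∈D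
    ++⟨ solve (t ∷ []) ⟩ ends-of blocks ∈B ++⟨ solve (t ∷ []) ⟩ ends-of blocks ∈E
    ++⟨ solve (t ∷ []) ⟩ starts-of blocks ∈A ++⟨ solve (t ∷ []) ⟩ ends-of blocks ∈F
    ++⟨ solve (t ∷ []) ⟩ fit (ends-of blocks ∈A) (solve (t ∷ []))

  odd-gaps : Segment (λ u → Gap blocks (1 + 2 * u)) 0 (2 * t + 4)
  odd-gaps =
       odd-gaps-of blocks ∈C 0 refl ++⟨ refl ⟩ odd-gaps-of blocks ∈D 1 refl
    ++⟨ solve (t ∷ []) ⟩ odd-gaps-of blocks ∈E (t + 1) (solve (t ∷ []))
    ++⟨ solve (t ∷ []) ⟩ odd-gaps-of blocks ∈B (t + 2) (solve (t ∷ []))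
    ++⟨ solve (t ∷ []) ⟩ fit (odd-gaps-of blocks ∈F (2 * t + 3) (solve (t ∷ []))) (solve (t ∷ []))

  even-gaps : Segment (λ u → Gap blocks (2 + 2 * u)) 0 (2 * t + 4)
  even-gaps = even-gaps-of blocks ∈A 0 refl

  system : SkolemSystem (8 + t * 4)
  system = blockSystem blocks blocks-total points
    (gaps-by-parity blocks (8 + t * 4) odd-gaps even-gaps
      (≤-reflexive (solve (t ∷ []))) (m≤n⇒m≤1+n (≤-reflexive (solve (t ∷ [])))))

module SkolemOrder9+4t (t : ℕ) where
  A B C D E F : Block
  A = block (4 * t + 10) 1 (2 * t + 4)
  B = block 1 (2 * t + 4) (t + 2)
  C = block (t + 3) 0 1
  D = block (t + 5) 2 t
  E = block (2 * t + 5) (4 * t + 8) 1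
  F = block (2 * t + 6) (2 * t + 2) 1

  blocks : List Block
  blocks = A ∷ B ∷ C ∷ D ∷ E ∷ F ∷ []

  ∈A : A ∈ blocks
  ∈A = here refl
  ∈B : B ∈ blocks
  ∈B = there (here refl)
  ∈C : C ∈ blocks
  ∈C = there (there (here refl))
  ∈D : D ∈ blocks
  ∈D = there (there (there (here refl)))
  ∈E : E ∈ blocks
  ∈E = there (there (there (there (here refl))))
  ∈F : F ∈ blocks
  ∈F = there (there (there (there (there (here refl)))))

  blocks-total : total blocks ≡ 9 + t * 4
  blocks-total = sizes t
    where
    sizes : ∀ t → 2 * t + 4 + (t + 2 + (1 + (t + (1 + (1 + 0))))) ≡ 9 + t * 4
    sizes = solve-∀

  points : Segment (Point blocks) 1 (suc ((9 + t * 4) + (9 + t * 4)))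
  points =
       starts-of blocks ∈B ++⟨ solve (t ∷ []) ⟩ starts-of blocks ∈C ++⟨ solve (t ∷ []) ⟩ ends-of blocks ∈C
    ++⟨ solve (t ∷ []) ⟩ starts-of blocks ∈D ++⟨ solve (t ∷ []) ⟩ starts-of blocks ∈E
    ++⟨ solve (t ∷ []) ⟩ starts-of blocks ∈F ++⟨ solve (t ∷ []) ⟩ ends-of blocks ∈D
    ++⟨ solve (t ∷ []) ⟩ ends-of blocks ∈B ++⟨ solve (t ∷ []) ⟩ ends-of blocks ∈F
    ++⟨ solve (t ∷ []) ⟩ starts-of blocks ∈A ++⟨ solve (t ∷ []) ⟩ ends-of blocks ∈E
    ++⟨ solve (t ∷ []) ⟩ fit (ends-of blocks ∈A) (solve (t ∷ []))

  odd-gaps : Segment (λ u → Gap blocks (1 + 2 * u)) 0 (2 * t + 5)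
  odd-gaps =
       odd-gaps-of blocks ∈C 0 refl ++⟨ refl ⟩ odd-gaps-of blocks ∈D 1 refl
    ++⟨ solve (t ∷ []) ⟩ odd-gaps-of blocks ∈F (t + 1) (solve (t ∷ []))
    ++⟨ solve (t ∷ []) ⟩ odd-gaps-of blocks ∈B (t + 2) (solve (t ∷ []))
    ++⟨ solve (t ∷ []) ⟩ fit (odd-gaps-of blocks ∈E (2 * t + 4) (solve (t ∷ []))) (solve (t ∷ []))

  even-gaps : Segment (λ u → Gap blocks (2 + 2 * u)) 0 (2 * t + 4)
  even-gaps = even-gaps-of blocks ∈A 0 refl

  system : SkolemSystem (9 + t * 4)
  system = blockSystem blocks blocks-total points
    (gaps-by-parity blocks (9 + t * 4) odd-gaps even-gaps
      (≤-trans (n≤1+n _) (≤-reflexive (solve (t ∷ [])))) (≤-reflexive (solve (t ∷ []))))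

skolem-0 : ∀ q → 1 ≤ q * 4 → SkolemSystem (q * 4)
skolem-0 zero          ()
skolem-0 1             _ = order4
skolem-0 (suc (suc t)) _ = SkolemOrder8+4t.system t

skolem-1 : ∀ q → SkolemSystem (1 + q * 4)
skolem-1 zero          = order1
skolem-1 1             = order5
skolem-1 (suc (suc t)) = SkolemOrder9+4t.system t

skolem : ∀ n → 1 ≤ n → n % 4 ≡ 0 ⊎ n % 4 ≡ 1 → SkolemSystem n
skolem n n≥1 (inj₁ n≡0) = subst SkolemSystem (sym (residue n 4 n≡0))
                                 (skolem-0 (n / 4) (subst (1 ≤_) (residue n 4 n≡0) n≥1))
skolem n n≥1 (inj₂ n≡1) = subst SkolemSystem (sym (residue n 4 n≡1)) (skolem-1 (n / 4))

mod4-cases : ∀ n → n % 4 ≡ 0 ⊎ n % 4 ≡ 1 ⊎ n % 4 ≡ 2 ⊎ n % 4 ≡ 3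
mod4-cases n with n % 4 | m%n<n n 4
... | 0 | _ = inj₁ refl
... | 1 | _ = inj₂ (inj₁ refl)
... | 2 | _ = inj₂ (inj₂ (inj₁ refl))
... | 3 | _ = inj₂ (inj₂ (inj₂ refl))
... | suc (suc (suc (suc _))) | s≤s (s≤s (s≤s (s≤s ())))

graceful⇒residue : ∀ n → SuperGraceful 1 (nK₂ n) → n % 4 ≡ 0 ⊎ n % 4 ≡ 1
graceful⇒residue n graceful with mod4-cases n
... | inj₁ n≡0                = inj₁ n≡0
... | inj₂ (inj₁ n≡1)         = inj₂ n≡1
... | inj₂ (inj₂ (inj₁ n≡2))  = contradiction graceful (not-graceful-2 n 1 n≡2 ≤-refl)
... | inj₂ (inj₂ (inj₂ n≡3))  = contradiction graceful (not-graceful-3 n 1 n≡3 ≤-refl refl)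

good-labeling : ∀ n → 1 ≤ n → n % 4 ≡ 0 ⊎ n % 4 ≡ 1 → GoodLabeling n
good-labeling n n≥1 residue-ok = skolem⇒labeling (skolem n n≥1 residue-ok)

corollary3p9 : (∀ n → 1 ≤ n →
    (SuperGraceful 1 (nK₂ n) ⇔ (n % 4 ≡ 0 ⊎ n % 4 ≡ 1)) ×
    ((n % 4 ≡ 0 ⊎ n % 4 ≡ 1) →
    Σ (Elem (nK₂ n) → ℕ) λ f → IsSuperGraceful 1 (nK₂ n) f × EdgeLabelSet (nK₂ n) f 1 n))
    ×
    (∀ n → 2 ≤ n →
    ((n % 4 ≡ 2 ⊎ n % 4 ≡ 3) → ∀ k → 1 ≤ k → k % 2 ≡ 1 → ¬ SuperGraceful k (nK₂ n)) ×
    (n % 4 ≡ 2 → ∀ k → 2 ≤ k → k % 2 ≡ 0 → ¬ SuperGraceful k (nK₂ n)) ×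
    (n % 4 ≡ 2 → ∀ k → 1 ≤ k → ¬ SuperGraceful k (nK₂ n)))
    ×
    (∀ n → 2 ≤ n → ¬ SuperGraceful n (nK₂ n))
corollary3p9 =
    (λ n n≥1 → mk⇔ (graceful⇒residue n) (λ ok → let f , graceful , _ = good-labeling n n≥1 ok in f , graceful)
             , good-labeling n n≥1)
  , (λ n _ → (λ { (inj₁ n≡2) k k≥1 _     → not-graceful-2 n k n≡2 k≥1
                ; (inj₂ n≡3) k k≥1 k-odd → not-graceful-3 n k n≡3 k≥1 k-odd })
           , (λ n≡2 k k≥2 _ → not-graceful-2 n k n≡2 (≤-trans (s≤s z≤n) k≥2))
           , (λ n≡2 k k≥1 → not-graceful-2 n k n≡2 k≥1))
  , not-n-graceful
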